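{- Let $m\ge n$ be positive integers and let $F\colon\mathbb{F}_2^m\to\mathbb{F}_2^n$. If $F$ has an APN extension, then $\Delta_F\le 2^{m-n+1}$.
   Context: For $F\colon\mathbb{F}_2^m\to\mathbb{F}_2^n$, $u\in\mathbb{F}_2^m\setminus\{0\}$, $v\in\mathbb{F}_2^n$, let $N_F(u,v)$ be the number of $x\in\mathbb{F}_2^m$ with $F(x+u)+F(x)=v$; the differential uniformity is $\Delta_F=\max_{u\neq0,v}N_F(u,v)$. An extension of $F$ is a function $G\colon\mathbb{F}_2^m\to\mathbb{F}_2^m$ of the form $G(x)=(F(x),h(x))$ for some $h\colon\mathbb{F}_2^m\to\mathbb{F}_2^{m-n}$ (i.e., obtained by adding coordinate functions). A function $G\colon\mathbb{F}_2^m\to\mathbb{F}_2^m$ is APN if $\Delta_G=2$. -}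

module Defs where

open import Data.Bool using (Bool; true; false; _xor_; if_then_else_)
open import Data.Nat using (ℕ; zero; suc; _+_; _⊔_)
open import Data.List using (List; []; _∷_; map; concatMap; foldr; filter; length)
open import Data.Vec using (Vec; []; _∷_; zipWith; replicate; _++_)
open import Data.Product using (_×_; _,_)
open import Relation.Nullary using (¬_; Dec; yes; no; ¬?)
open import Relation.Binary.PropositionalEquality using (_≡_)
import Data.Vec.Properties as VecP
import Data.Bool.Properties as BoolP

𝔽₂^ : ℕ → Set
𝔽₂^ k = Vec Bool k

_⊕_ : {k : ℕ} → 𝔽₂^ k → 𝔽₂^ k → 𝔽₂^ k
_⊕_ = zipWith _xor_

𝟎 : {k : ℕ} → 𝔽₂^ k
𝟎 = replicate _ false

_≟v_ : {k : ℕ} → (x y : 𝔽₂^ k) → Dec (x ≡ y)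
_≟v_ = VecP.≡-dec BoolP._≟_

allVecs : (k : ℕ) → List (𝔽₂^ k)
allVecs zero = [] ∷ []
allVecs (suc k) = concatMap (λ x → (false ∷ x) ∷ (true ∷ x) ∷ []) (allVecs k)

nonzeroVecs : (k : ℕ) → List (𝔽₂^ k)
nonzeroVecs k = filter (λ u → ¬? (u ≟v 𝟎)) (allVecs k)

N : {m n : ℕ} → (𝔽₂^ m → 𝔽₂^ n) → 𝔽₂^ m → 𝔽₂^ n → ℕ
N {m} F u v = length (filter (λ x → (F (x ⊕ u) ⊕ F x) ≟v v) (allVecs m))

maximum : List ℕ → ℕ
maximum = foldr _⊔_ 0

Δ : {m n : ℕ} → (𝔽₂^ m → 𝔽₂^ n) → ℕ
Δ {m} {n} F =
  maximum (concatMap (λ u → map (λ v → N F u v) (allVecs n)) (nonzeroVecs m))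

APN : {k : ℕ} → (𝔽₂^ k → 𝔽₂^ k) → Set
APN G = Δ G ≡ 2

-- G is an extension of F : 𝔽₂^m → 𝔽₂^n with n ≤ m: G(x) = (F(x), h(x))
-- for some h : 𝔽₂^m → 𝔽₂^(m-n).  Since 𝔽₂^n × 𝔽₂^(m-n) has length
-- n + (m ∸ n) (definitionally not m), an APN extension is phrased directly
-- via h: the function x ↦ F x ++ h x must be APN, transported along n + (m ∸ n) ≡ m.

open import Data.Nat using (_≤_)
open import Data.Nat.Properties using (m+[n∸m]≡n)
open import Data.Product using (∃)
open import Relation.Binary.PropositionalEquality using (subst)

extend : {m n : ℕ} → n ≤ m → (𝔽₂^ m → 𝔽₂^ n) → (𝔽₂^ m → 𝔽₂^ (m Data.Nat.∸ n)) →
         𝔽₂^ m → 𝔽₂^ m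
extend {m} {n} n≤m F h x = subst 𝔽₂^ (m+[n∸m]≡n n≤m) (F x ++ h x)

HasAPNExtension : {m n : ℕ} → n ≤ m → (𝔽₂^ m → 𝔽₂^ n) → Set
HasAPNExtension {m} {n} n≤m F =
  ∃ λ (h : 𝔽₂^ m → 𝔽₂^ (m Data.Nat.∸ n)) → APN (extend n≤m F h)

{-# OPTIONS --safe #-}
-- The derivative of G = (F , h) in direction u is (D_u F , D_u h). Hence every solution x
-- of D_u F x = v solves D_u G x = (v , w) for w = D_u h x, and summing over the 2^(m-n)
-- possible w gives N_F(u,v) ≤ 2^(m-n) · Δ_G.
module Submission where

open import Defs
open import Level using (Level)
open import Function using (_∘′_)
open import Data.Nat using (ℕ; suc; _≤_; _<_; _∸_; _^_; _+_; _*_; _⊔_; z≤n; s≤s)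
open import Data.Nat.Properties
  using (≤-refl; ≤-reflexive; n≤1+n; ≤-trans; +-mono-≤; +-mono-<-≤; +-mono-≤-<; *-comm; ⊔-lub;
         m⊔n≤o⇒m≤o; m⊔n≤o⇒n≤o; m+[n∸m]≡n; ^-distribˡ-+-*; module ≤-Reasoning)
open import Data.Nat.ListAction using (sum)
open import Data.Bool using (true; false; _xor_)
open import Data.List using (List; []; _∷_; map; concatMap; filter; length)
open import Data.List.Properties using (length-++; filter-accept; foldr-preservesᵇ; foldr-forcesᵇ)
open import Data.List.Membership.Propositional using (_∈_; lose)
open import Data.List.Membership.Propositional.Properties using (∈-map⁺; ∈-concatMap⁺)
open import Data.List.Relation.Unary.Any using (here; there)
open import Data.List.Relation.Unary.All as All using (All)
open import Data.List.Relation.Unary.All.Properties using (concat⁺; map⁺)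
open import Data.Vec using (_∷_) renaming ([] to []ᵥ; _++_ to _++ᵥ_)
open import Data.Vec.Properties using (zipWith-++)
open import Data.Product using (∃; _×_; _,_)
open import Relation.Nullary using (yes; no)
open import Relation.Unary using (Pred; Decidable)
open import Relation.Binary.PropositionalEquality
  using (_≡_; refl; sym; trans; cong; cong₂; subst; module ≡-Reasoning)

private
  variable
    a b p q : Level
    A : Set a
    B : Set b
    m n : ℕ

maximum-upper : ∀ {x} xs → x ∈ xs → x ≤ maximum xs
maximum-upper xs = All.lookup (foldr-forcesᵇ split 0 xs ≤-refl)
  where
  split : ∀ x y → x ⊔ y ≤ maximum xs → x ≤ maximum xs × y ≤ maximum xs
  split x y x⊔y≤ = m⊔n≤o⇒m≤o x y x⊔y≤ , m⊔n≤o⇒n≤o x y x⊔y≤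

maximum-least : ∀ {xs c} → All (_≤ c) xs → maximum xs ≤ c
maximum-least = foldr-preservesᵇ ⊔-lub z≤n

sum-map-mono-≤ : {f g : A → ℕ} → (∀ w → f w ≤ g w) → ∀ ws → sum (map f ws) ≤ sum (map g ws)
sum-map-mono-≤ f≤g []       = z≤n
sum-map-mono-≤ f≤g (w ∷ ws) = +-mono-≤ (f≤g w) (sum-map-mono-≤ f≤g ws)

sum-map-mono-< : {f g : A → ℕ} → (∀ w → f w ≤ g w) → ∀ {w ws} → w ∈ ws → f w < g w →
  sum (map f ws) < sum (map g ws)
sum-map-mono-< f≤g {ws = w ∷ ws} (here refl) fw<gw = +-mono-<-≤ fw<gw (sum-map-mono-≤ f≤g ws)
sum-map-mono-< f≤g {ws = w ∷ ws} (there w∈) fw<gw = +-mono-≤-< (f≤g w) (sum-map-mono-< f≤g w∈ fw<gw)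

sum-map-≤-length-* : {f : A → ℕ} {c : ℕ} → ∀ ws → (∀ w → f w ≤ c) → sum (map f ws) ≤ length ws * c
sum-map-≤-length-* []       f≤c = z≤n
sum-map-≤-length-* (w ∷ ws) f≤c = +-mono-≤ (f≤c w) (sum-map-≤-length-* ws f≤c)

length-concatMap-const : {f : A → List B} {c : ℕ} → (∀ x → length (f x) ≡ c) → ∀ xs →
  length (concatMap f xs) ≡ length xs * c
length-concatMap-const         fx≡c []       = refl
length-concatMap-const {f = f} fx≡c (x ∷ xs) =
  trans (length-++ (f x)) (cong₂ _+_ (fx≡c x) (length-concatMap-const fx≡c xs))

module _ {P : Pred A p} (P? : Decidable P) where

  length-filter-∷-≤ : ∀ x xs → length (filter P? xs) ≤ length (filter P? (x ∷ xs))
  length-filter-∷-≤ x xs with P? x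
  ... | yes _ = n≤1+n _
  ... | no  _ = ≤-refl

  length-filter-∷-< : ∀ {x} xs → P x → length (filter P? xs) < length (filter P? (x ∷ xs))
  length-filter-∷-< xs px = ≤-reflexive (sym (cong length (filter-accept P? px)))

length-filter-≤-sum-cover : {P : Pred A p} (P? : Decidable P)
  {Q : B → Pred A q} (Q? : ∀ w → Decidable (Q w)) (ws : List B) →
  (∀ {x} → P x → ∃ λ w → w ∈ ws × Q w x) →
  ∀ xs → length (filter P? xs) ≤ sum (map (λ w → length (filter (Q? w) xs)) ws)
length-filter-≤-sum-cover P? Q? ws cover []       = z≤n
length-filter-≤-sum-cover P? Q? ws cover (x ∷ xs) with P? x
... | yes px = let w , w∈ws , qwx = cover px in
  ≤-trans (s≤s (length-filter-≤-sum-cover P? Q? ws cover xs))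
          (sum-map-mono-< (λ w → length-filter-∷-≤ (Q? w) x xs) w∈ws (length-filter-∷-< (Q? w) xs qwx))
... | no  _  =
  ≤-trans (length-filter-≤-sum-cover P? Q? ws cover xs)
          (sum-map-mono-≤ (λ w → length-filter-∷-≤ (Q? w) x xs) ws)

allVecs-complete : ∀ k (x : 𝔽₂^ k) → x ∈ allVecs k
allVecs-complete 0       []ᵥ         = here refl
allVecs-complete (suc k) (false ∷ x) = ∈-concatMap⁺ _ (lose (allVecs-complete k x) (here refl))
allVecs-complete (suc k) (true  ∷ x) = ∈-concatMap⁺ _ (lose (allVecs-complete k x) (there (here refl)))

allVecs-length : ∀ k → length (allVecs k) ≡ 2 ^ k
allVecs-length 0       = refl
allVecs-length (suc k) = begin
  length (allVecs (suc k)) ≡⟨ length-concatMap-const (λ _ → refl) (allVecs k) ⟩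
  length (allVecs k) * 2   ≡⟨ cong (_* 2) (allVecs-length k) ⟩
  2 ^ k * 2                ≡⟨ *-comm (2 ^ k) 2 ⟩
  2 ^ suc k                ∎
  where open ≡-Reasoning

N≤Δ : (F : 𝔽₂^ m → 𝔽₂^ n) {u : 𝔽₂^ m} → u ∈ nonzeroVecs m → ∀ v → N F u v ≤ Δ F
N≤Δ {n = n} F u∈ v = maximum-upper _ (∈-concatMap⁺ _ (lose u∈ (∈-map⁺ (N F _) (allVecs-complete n v))))

Δ-least : (F : 𝔽₂^ m → 𝔽₂^ n) {c : ℕ} → (∀ {u} → u ∈ nonzeroVecs m → ∀ v → N F u v ≤ c) → Δ F ≤ c
Δ-least F N≤c = maximum-least (concat⁺ (map⁺ (All.tabulate λ u∈ → map⁺ (All.universal (N≤c u∈) _))))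

derivative : (𝔽₂^ m → 𝔽₂^ n) → 𝔽₂^ m → 𝔽₂^ m → 𝔽₂^ n
derivative F u x = F (x ⊕ u) ⊕ F x

append : n ≤ m → 𝔽₂^ n → 𝔽₂^ (m ∸ n) → 𝔽₂^ m
append {n} {m} n≤m v w = subst 𝔽₂^ (m+[n∸m]≡n n≤m) (v ++ᵥ w)

subst-⊕ : ∀ {k l} (k≡l : k ≡ l) (x y : 𝔽₂^ k) →
  subst 𝔽₂^ k≡l x ⊕ subst 𝔽₂^ k≡l y ≡ subst 𝔽₂^ k≡l (x ⊕ y)
subst-⊕ refl x y = refl

append-⊕ : (n≤m : n ≤ m) (v v′ : 𝔽₂^ n) (w w′ : 𝔽₂^ (m ∸ n)) →
  append n≤m v w ⊕ append n≤m v′ w′ ≡ append n≤m (v ⊕ v′) (w ⊕ w′)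
append-⊕ n≤m v v′ w w′ =
  trans (subst-⊕ (m+[n∸m]≡n n≤m) _ _) (cong (subst 𝔽₂^ (m+[n∸m]≡n n≤m)) (zipWith-++ _xor_ v w v′ w′))

derivative-extend : (n≤m : n ≤ m) (F : 𝔽₂^ m → 𝔽₂^ n) (h : 𝔽₂^ m → 𝔽₂^ (m ∸ n)) (u x : 𝔽₂^ m) →
  derivative (extend n≤m F h) u x ≡ append n≤m (derivative F u x) (derivative h u x)
derivative-extend n≤m F h u x = append-⊕ n≤m (F (x ⊕ u)) (F x) (h (x ⊕ u)) (h x)

module _ (n≤m : n ≤ m) (F : 𝔽₂^ m → 𝔽₂^ n) (h : 𝔽₂^ m → 𝔽₂^ (m ∸ n)) where

  private
    G : 𝔽₂^ m → 𝔽₂^ m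
    G = extend n≤m F h

  N≤sum-N-extend : ∀ u v → N F u v ≤ sum (map (N G u ∘′ append n≤m v) (allVecs (m ∸ n)))
  N≤sum-N-extend u v = length-filter-≤-sum-cover
    (λ x → derivative F u x ≟v v) (λ w x → derivative G u x ≟v append n≤m v w)
    (allVecs (m ∸ n)) cover (allVecs m)
    where
    cover : ∀ {x} → derivative F u x ≡ v →
      ∃ λ w → w ∈ allVecs (m ∸ n) × derivative G u x ≡ append n≤m v w
    cover {x} refl = derivative h u x , allVecs-complete _ _ , derivative-extend n≤m F h u x

  Δ≤2^[m∸n]*Δ-extend : Δ F ≤ 2 ^ (m ∸ n) * Δ G
  Δ≤2^[m∸n]*Δ-extend = Δ-least F λ {u} u∈ v → begin
    N F u v
      ≤⟨ N≤sum-N-extend u v ⟩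
    sum (map (N G u ∘′ append n≤m v) (allVecs (m ∸ n)))
      ≤⟨ sum-map-≤-length-* (allVecs (m ∸ n)) (λ w → N≤Δ G u∈ (append n≤m v w)) ⟩
    length (allVecs (m ∸ n)) * Δ G
      ≡⟨ cong (_* Δ G) (allVecs-length (m ∸ n)) ⟩
    2 ^ (m ∸ n) * Δ G
      ∎
    where open ≤-Reasoning

lemma4 : (m n : ℕ) → 1 ≤ n → (n≤m : n ≤ m) → (F : 𝔽₂^ m → 𝔽₂^ n) →
    HasAPNExtension n≤m F → Δ F ≤ 2 ^ (m ∸ n + 1)
lemma4 m n _ n≤m F (h , G-apn) = begin
  Δ F                               ≤⟨ Δ≤2^[m∸n]*Δ-extend n≤m F h ⟩
  2 ^ (m ∸ n) * Δ (extend n≤m F h)  ≡⟨ cong (2 ^ (m ∸ n) *_) G-apn ⟩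
  2 ^ (m ∸ n) * 2                   ≡⟨ ^-distribˡ-+-* 2 (m ∸ n) 1 ⟨
  2 ^ (m ∸ n + 1)                   ∎
  where open ≤-Reasoning
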